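{- For every $\varepsilon>0$ there exists $k$ with the following property. Let $1/2=p_0<p_1<\dots<p_{k-1}$ be the elements of $P_k$ in increasing order, and set $p_k=1$. Then $p_{j+1}-p_j<\varepsilon$ for all $j=0,\dots,k-1$.
   Context: For $k\ge 1$ let $P_k=\left\{\dfrac{2^{\lceil i\log_2 3\rceil-1}}{3^i}:0\le i<k\right\}$. Every element of $P_k$ lies in $[1/2,1)$, and the element for $i=0$ equals $1/2$.
   Formalization: The quantity ε ranges over the positive rationals. -}

module Defs where

open import Data.Nat using (ℕ; _^_; _*_; NonZero)
open import Data.Nat.Properties using (m^n≢0; m*n≢0)
open import Data.Nat.Logarithm using (⌈log₂_⌉)
open import Data.Integer using (+_)
open import Data.Rational using (ℚ; _/_)
open import Data.List using (List; map; upTo)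

den : ℕ → ℕ
den i = 2 * 3 ^ i

den≢0 : ∀ i → NonZero (den i)
den≢0 i = m*n≢0 2 (3 ^ i) {{_}} {{m^n≢0 3 i}}

-- ⌈ i log₂ 3 ⌉ = ⌈ log₂ (3^i) ⌉
ce : ℕ → ℕ
ce i = ⌈log₂ (3 ^ i) ⌉

-- 2^(⌈i log₂ 3⌉ - 1) / 3^i  written as  2^⌈i log₂ 3⌉ / (2 · 3^i)
pelem : ℕ → ℚ
pelem i = _/_ (+ (2 ^ ce i)) (den i) {{den≢0 i}}

P : ℕ → List ℚ
P k = map pelem (upTo k)

-- Write ρ i = 2 ^ ⌈i log₂ 3⌉ / 3 ^ i = 2 · pelem i ∈ [1, 2). Since ⌈x⌉ + ⌈y⌉ is ⌈x + y⌉ or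
-- ⌈x + y⌉ + 1, ρ (a + b) is either ρ a · ρ b or ρ a · ρ b / 2. Given M, the pigeonhole principle
-- applied to ⌊M ρ x⌋ ∈ [M, 2M) for x = 0, …, M yields d ≥ 1 with ρ d ∈ (1, 1 + 1/M] or
-- ρ d ∈ [2M/(M + 1), 2). In the first case ρ (m d) = ρ d ^ m climbs from 1 in steps of ratio at
-- most 1 + 1/M until it would pass 2; in the second ρ (m d) = 2 (ρ d / 2) ^ m descends from ρ d in
-- such steps until it would pass 1. Bernoulli's inequality bounds either walk by 2 ^ ⌈d log₂ 3⌉
-- steps, so for a suitable k every pelem i is within 1/M of 1 or lies below some pelem j, j < k,
-- by less than 1/M. In the sorted list of P k this bounds every gap, including the last one to 1.
module Submission where

module Ratios where

  open import Defs using (ce)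
  open import Data.Empty using (⊥)
  open import Data.Fin.Base using (Fin; toℕ; fromℕ<)
  open import Data.Fin.Properties using (pigeonhole; toℕ-fromℕ<)
  open import Data.List.Base using (_∷_; [])
  open import Data.Nat.Base
  open import Data.Nat.DivMod using (_/_; m/n*n≤m; m%n<n; m≡m%n+[m/n]*n; m*n/n≡m; /-monoˡ-≤; m<n*o⇒m/o<n)
  open import Data.Nat.Logarithm using (⌈log₂_⌉; ⌈log₂⌉-mono-≤; ⌈log₂2^n⌉≡n)
  open import Data.Nat.Logarithm.Core using (⌈log2⌉)
  open import Data.Nat.Properties
  open import Algebra.Properties.CommutativeSemigroup *-commutativeSemigroup using (x∙yz≈y∙xz)
  open import Data.Nat.Tactic.RingSolver using (solve-∀; solve)
  open import Data.Product.Base using (∃-syntax; _×_; _,_; proj₁; proj₂)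
  open import Data.Sum.Base using (_⊎_; inj₁; inj₂; [_,_]′)
  open import Function.Base using (_∘_)
  open import Induction.WellFounded using (acc)
  open import Relation.Binary.PropositionalEquality
  open import Relation.Nullary using (¬_; contradiction; yes; no)
  open import Relation.Nullary.Decidable using (_⊎-dec_)
  open import Relation.Unary using (Decidable)

  n≤2*⌈n/2⌉ : ∀ n → n ≤ 2 * ⌈ n /2⌉
  n≤2*⌈n/2⌉ n = begin
    n                       ≡⟨ ⌊n/2⌋+⌈n/2⌉≡n n ⟨
    ⌊ n /2⌋ + ⌈ n /2⌉       ≤⟨ +-monoˡ-≤ ⌈ n /2⌉ (⌊n/2⌋≤⌈n/2⌉ n) ⟩
    ⌈ n /2⌉ + ⌈ n /2⌉       ≡⟨ cong (⌈ n /2⌉ +_) (+-identityʳ ⌈ n /2⌉) ⟨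
    2 * ⌈ n /2⌉             ∎
    where open ≤-Reasoning

  n≤2^⌈log₂n⌉ : ∀ n → n ≤ 2 ^ ⌈log₂ n ⌉
  n≤2^⌈log₂n⌉ n = go n _
    where
    go : ∀ n acc → n ≤ 2 ^ ⌈log2⌉ n acc
    go 0 _ = z≤n
    go 1 _ = ≤-refl
    go (suc (suc n)) (acc rs) = begin
      2 + n                   ≤⟨ +-monoʳ-≤ 2 (n≤2*⌈n/2⌉ n) ⟩
      2 + 2 * ⌈ n /2⌉         ≡⟨ *-suc 2 ⌈ n /2⌉ ⟨
      2 * suc ⌈ n /2⌉         ≤⟨ *-monoʳ-≤ 2 (go (suc ⌈ n /2⌉) _) ⟩
      2 * 2 ^ ⌈log2⌉ (suc ⌈ n /2⌉) _ ∎
      where open ≤-Reasoning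

  ⌈log₂⌉-least : ∀ {n} e → n ≤ 2 ^ e → ⌈log₂ n ⌉ ≤ e
  ⌈log₂⌉-least e n≤2^e = ≤-trans (⌈log₂⌉-mono-≤ n≤2^e) (≤-reflexive (⌈log₂2^n⌉≡n e))

  2^⌈log₂n⌉<2n : ∀ n .{{_ : NonZero n}} → 2 ^ ⌈log₂ n ⌉ < 2 * n
  2^⌈log₂n⌉<2n n with ⌈log₂ n ⌉ in eq
  ... | zero  = *-monoʳ-≤ 2 {1} {n} (>-nonZero⁻¹ n)
  ... | suc e = *-monoʳ-< 2 {2 ^ e} {n} (≰⇒> λ n≤2^e → <⇒≱ (n<1+n e) (subst (_≤ e) eq (⌈log₂⌉-least _ n≤2^e)))

  ⌈log₂⌉-unique : ∀ {n} e → n ≤ 2 ^ e → 2 ^ e < 2 * n → ⌈log₂ n ⌉ ≡ e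
  ⌈log₂⌉-unique {n} e n≤2^e 2^e<2n = ≤-antisym (⌈log₂⌉-least _ n≤2^e) (≮⇒≥ too-small)
    where
    too-small : ⌈log₂ n ⌉ < e → ⊥
    too-small lt = <-irrefl refl (<-≤-trans 2^e<2n (begin
      2 * n                    ≤⟨ *-monoʳ-≤ 2 (n≤2^⌈log₂n⌉ n) ⟩
      2 ^ suc ⌈log₂ n ⌉        ≤⟨ ^-monoʳ-≤ 2 lt ⟩
      2 ^ e                    ∎))
      where open ≤-Reasoning

  ^-distribʳ-* : ∀ a b m → (a * b) ^ m ≡ a ^ m * b ^ m
  ^-distribʳ-* a b zero    = refl
  ^-distribʳ-* a b (suc m) =
    trans (cong (a * b *_) (^-distribʳ-* a b m)) ([m*n]*[o*p]≡[m*o]*[n*p] a b (a ^ m) (b ^ m))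

  bernoulli : ∀ h m → h ^ m * (h + m) ≤ h * suc h ^ m
  bernoulli h zero = ≤-reflexive (solve (h ∷ []))
  bernoulli h (suc m) = begin
    h * h ^ m * (h + suc m)              ≡⟨ split h (h ^ m) m ⟩
    h * (h ^ m * (h + m)) + h * h ^ m    ≤⟨ +-mono-≤ (*-monoʳ-≤ h (bernoulli h m)) (*-monoʳ-≤ h (^-monoˡ-≤ m (n≤1+n h))) ⟩
    h * (h * suc h ^ m) + h * suc h ^ m  ≡⟨ merge h (suc h ^ m) ⟩
    h * (suc h * suc h ^ m)              ∎
    where
    open ≤-Reasoning
    split : ∀ h p m → h * p * (h + suc m) ≡ h * (p * (h + m)) + h * p
    split = solve-∀
    merge : ∀ h q → h * (h * q) + h * q ≡ h * (suc h * q)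
    merge = solve-∀

  -- (y/h)^m < 2 with y/h ≥ 1 + 1/h forces m < h, since (1 + 1/h)^m ≥ 1 + m/h.
  exponent-bound : ∀ h y m .{{_ : NonZero h}} → suc h ≤ y → y ^ m < 2 * h ^ m → m < h
  exponent-bound h y m h<y y^m<2h^m =
    +-cancelˡ-< h m h (*-cancelˡ-< (h ^ m) (h + m) (h + h) (begin-strict
      h ^ m * (h + m)   ≤⟨ bernoulli h m ⟩
      h * suc h ^ m     ≤⟨ *-monoʳ-≤ h (^-monoˡ-≤ m h<y) ⟩
      h * y ^ m         <⟨ *-monoʳ-< h y^m<2h^m ⟩
      h * (2 * h ^ m)   ≡⟨ regroup h (h ^ m) ⟩
      h ^ m * (h + h)   ∎))
    where
    open ≤-Reasoning
    regroup : ∀ h p → h * (2 * p) ≡ p * (h + h)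
    regroup = solve-∀

  3^n-odd : ∀ n → ∃[ y ] 3 ^ n ≡ suc (2 * y)
  3^n-odd zero = 0 , refl
  3^n-odd (suc n) with y , 3^n≡1+2y ← 3^n-odd n = suc (3 * y) , trans (cong (3 *_) 3^n≡1+2y) (triple y)
    where
    triple : ∀ y → 3 * suc (2 * y) ≡ suc (2 * suc (3 * y))
    triple = solve-∀

  2^m≢3^n : ∀ m n .{{_ : NonZero n}} → 2 ^ m ≢ 3 ^ n
  2^m≢3^n zero    n eq = <-irrefl eq (<-≤-trans (s≤s (s≤s z≤n)) (^-monoʳ-≤ 3 (>-nonZero⁻¹ n)))
  2^m≢3^n (suc m) n eq with y , 3^n≡1+2y ← 3^n-odd n = even≢odd (2 ^ m) y (trans eq 3^n≡1+2y)

  module _ {Inv Stop : ℕ → Set} (Stop? : Decidable Stop) (N : ℕ)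
           (bounded : ∀ m → Inv m → m < N) (continue : ∀ m → Inv m → ¬ Stop m → Inv (suc m)) where

    halts : ∀ {m} → Inv m → ∃[ n ] Inv n × Stop n
    halts {m} = go N (m≤m+n N m)
      where
      go : ∀ fuel {m} → N ≤ fuel + m → Inv m → ∃[ n ] Inv n × Stop n
      go zero {m}   N≤m inv = contradiction (bounded m inv) (≤⇒≯ N≤m)
      go (suc fuel) {m} N≤ inv with Stop? m
      ... | yes stop = m , inv , stop
      ... | no ¬stop = go fuel (subst (N ≤_) (sym (+-suc fuel m)) N≤) (continue m inv ¬stop)

  -- A pair t / s stands for a ratio ρ: t₂ * s₁ ≤ t₁ * s₂ is ρ₂ ≤ ρ₁, and
  -- M * t₂ * s₁ ≤ suc M * t₁ * s₂ is ρ₂ ≤ (1 + 1/M) ρ₁.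
  close-resp-≤ : ∀ M t₁ s₁ t₂ s₂ t₃ s₃ .{{_ : NonZero s₁}} →
    M * t₂ * s₁ ≤ suc M * t₁ * s₂ → t₁ * s₃ ≤ t₃ * s₁ → M * t₂ * s₃ ≤ suc M * t₃ * s₂
  close-resp-≤ M t₁ s₁ t₂ s₂ t₃ s₃ close ρ₁≤ρ₃ = *-cancelˡ-≤ s₁ (begin
    s₁ * (M * t₂ * s₃)        ≡⟨ solve (M ∷ s₁ ∷ t₂ ∷ s₃ ∷ []) ⟩
    s₃ * (M * t₂ * s₁)        ≤⟨ *-monoʳ-≤ s₃ close ⟩
    s₃ * (suc M * t₁ * s₂)    ≡⟨ solve (M ∷ t₁ ∷ s₂ ∷ s₃ ∷ []) ⟩
    suc M * s₂ * (t₁ * s₃)    ≤⟨ *-monoʳ-≤ (suc M * s₂) ρ₁≤ρ₃ ⟩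
    suc M * s₂ * (t₃ * s₁)    ≡⟨ solve (M ∷ s₁ ∷ s₂ ∷ t₃ ∷ []) ⟩
    s₁ * (suc M * t₃ * s₂)    ∎)
    where open ≤-Reasoning

  below-two-resp-≤ : ∀ M t₁ s₁ t₂ s₂ .{{_ : NonZero s₁}} →
    2 * M * s₁ ≤ suc M * t₁ → t₁ * s₂ ≤ t₂ * s₁ → 2 * M * s₂ ≤ suc M * t₂
  below-two-resp-≤ M t₁ s₁ t₂ s₂ below ρ₁≤ρ₂ = *-cancelˡ-≤ s₁ (begin
    s₁ * (2 * M * s₂)         ≡⟨ solve (M ∷ s₁ ∷ s₂ ∷ []) ⟩
    s₂ * (2 * M * s₁)         ≤⟨ *-monoʳ-≤ s₂ below ⟩
    s₂ * (suc M * t₁)         ≡⟨ solve (M ∷ t₁ ∷ s₂ ∷ []) ⟩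
    suc M * (t₁ * s₂)         ≤⟨ *-monoʳ-≤ (suc M) ρ₁≤ρ₂ ⟩
    suc M * (t₂ * s₁)         ≡⟨ solve (M ∷ s₁ ∷ t₂ ∷ []) ⟩
    s₁ * (suc M * t₂)         ∎)
    where open ≤-Reasoning

  step-up-close : ∀ M t₁ s₁ t₂ s₂ t₃ →
    M * t₁ ≤ suc M * s₁ → t₃ ≤ t₁ * t₂ → M * t₃ * s₂ ≤ suc M * t₂ * (s₁ * s₂)
  step-up-close M t₁ s₁ t₂ s₂ t₃ close-to-1 t₃≤t₁t₂ = begin
    M * t₃ * s₂               ≤⟨ *-monoˡ-≤ s₂ (*-monoʳ-≤ M t₃≤t₁t₂) ⟩
    M * (t₁ * t₂) * s₂        ≡⟨ solve (M ∷ t₁ ∷ t₂ ∷ s₂ ∷ []) ⟩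
    M * t₁ * (t₂ * s₂)        ≤⟨ *-monoˡ-≤ (t₂ * s₂) close-to-1 ⟩
    suc M * s₁ * (t₂ * s₂)    ≡⟨ solve (M ∷ s₁ ∷ t₂ ∷ s₂ ∷ []) ⟩
    suc M * t₂ * (s₁ * s₂)    ∎
    where open ≤-Reasoning

  step-down-close : ∀ M t₁ s₁ t₂ s₂ t₃ .{{_ : NonZero t₁}} →
    2 * M * s₁ ≤ suc M * t₁ → t₁ * t₂ ≤ 2 * t₃ → M * t₂ * (s₁ * s₂) ≤ suc M * t₃ * s₂
  step-down-close M t₁ s₁ t₂ s₂ t₃ close-to-2 t₁t₂≤2t₃ = *-cancelˡ-≤ t₁ (begin
    t₁ * (M * t₂ * (s₁ * s₂)) ≡⟨ solve (M ∷ t₁ ∷ s₁ ∷ t₂ ∷ s₂ ∷ []) ⟩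
    M * (s₁ * s₂) * (t₁ * t₂) ≤⟨ *-monoʳ-≤ (M * (s₁ * s₂)) t₁t₂≤2t₃ ⟩
    M * (s₁ * s₂) * (2 * t₃)  ≡⟨ solve (M ∷ s₁ ∷ s₂ ∷ t₃ ∷ []) ⟩
    2 * M * s₁ * (t₃ * s₂)    ≤⟨ *-monoˡ-≤ (t₃ * s₂) close-to-2 ⟩
    suc M * t₁ * (t₃ * s₂)    ≡⟨ solve (M ∷ t₁ ∷ s₂ ∷ t₃ ∷ []) ⟩
    t₁ * (suc M * t₃ * s₂)    ∎)
    where open ≤-Reasoning

  wrap-below-two : ∀ M t₁ s₁ t₂ s₂ .{{_ : NonZero s₁}} →
    M * t₁ ≤ suc M * s₁ → 2 * (s₁ * s₂) ≤ t₁ * t₂ → 2 * M * s₂ ≤ suc M * t₂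
  wrap-below-two M t₁ s₁ t₂ s₂ close-to-1 wrap = *-cancelˡ-≤ s₁ (begin
    s₁ * (2 * M * s₂)         ≡⟨ solve (M ∷ s₁ ∷ s₂ ∷ []) ⟩
    M * (2 * (s₁ * s₂))       ≤⟨ *-monoʳ-≤ M wrap ⟩
    M * (t₁ * t₂)             ≡⟨ solve (M ∷ t₁ ∷ t₂ ∷ []) ⟩
    M * t₁ * t₂               ≤⟨ *-monoˡ-≤ t₂ close-to-1 ⟩
    suc M * s₁ * t₂           ≡⟨ solve (M ∷ s₁ ∷ t₂ ∷ []) ⟩
    s₁ * (suc M * t₂)         ∎)
    where open ≤-Reasoning

  drop-above-one : ∀ M t₁ s₁ t₂ s₂ .{{_ : NonZero t₁}} →
    2 * M * s₁ ≤ suc M * t₁ → t₁ * t₂ ≤ 2 * (s₁ * s₂) → M * t₂ ≤ suc M * s₂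
  drop-above-one M t₁ s₁ t₂ s₂ close-to-2 drop = *-cancelˡ-≤ t₁ (begin
    t₁ * (M * t₂)             ≡⟨ solve (M ∷ t₁ ∷ t₂ ∷ []) ⟩
    M * (t₁ * t₂)             ≤⟨ *-monoʳ-≤ M drop ⟩
    M * (2 * (s₁ * s₂))       ≡⟨ solve (M ∷ s₁ ∷ s₂ ∷ []) ⟩
    2 * M * s₁ * s₂           ≤⟨ *-monoˡ-≤ s₂ close-to-2 ⟩
    suc M * t₁ * s₂           ≡⟨ solve (M ∷ t₁ ∷ s₂ ∷ []) ⟩
    t₁ * (suc M * s₂)         ∎)
    where open ≤-Reasoning

  close-of-above-one : ∀ M t₁ s₁ t₂ s₂ →
    M * t₂ ≤ suc M * s₂ → s₁ ≤ t₁ → M * t₂ * s₁ ≤ suc M * t₁ * s₂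
  close-of-above-one M t₁ s₁ t₂ s₂ close-to-1 s₁≤t₁ = begin
    M * t₂ * s₁               ≤⟨ *-monoˡ-≤ s₁ close-to-1 ⟩
    suc M * s₂ * s₁           ≤⟨ *-monoʳ-≤ (suc M * s₂) s₁≤t₁ ⟩
    suc M * s₂ * t₁           ≡⟨ solve (M ∷ t₁ ∷ s₂ ∷ []) ⟩
    suc M * t₁ * s₂           ∎
    where open ≤-Reasoning

  ratio-weaken : ∀ M Q X Y → M ≤ Q → Q * X < suc Q * Y → M * X < suc M * Y
  ratio-weaken M Q X Y M≤Q lt = ≰⇒> λ ge → <-irrefl refl (<-≤-trans lt (big ge))
    where
    open ≤-Reasoning
    r = Q ∸ M
    big : suc M * Y ≤ M * X → suc Q * Y ≤ Q * X
    big ge = begin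
      suc Q * Y               ≡⟨ cong (λ q → suc q * Y) (m+[n∸m]≡n M≤Q) ⟨
      suc (M + r) * Y         ≡⟨ *-distribʳ-+ Y (suc M) r ⟩
      suc M * Y + r * Y       ≤⟨ +-mono-≤ ge (*-monoʳ-≤ r Y≤X) ⟩
      M * X + r * X           ≡⟨ *-distribʳ-+ X M r ⟨
      (M + r) * X             ≡⟨ cong (_* X) (m+[n∸m]≡n M≤Q) ⟩
      Q * X                   ∎
      where
      Y≤X : Y ≤ X
      Y≤X = *-cancelˡ-≤ (suc M) (≤-trans ge (*-monoˡ-≤ X (n≤1+n M)))

  same-floor-close : ∀ M Q t s t' s' .{{_ : NonZero M}} .{{_ : NonZero t}} →
    M ≤ Q → Q * s ≤ M * t → M * t' < suc Q * s' → M * t' * s < suc M * t * s'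
  same-floor-close M Q t s t' s' M≤Q lo hi = *-cancelˡ-< M _ _ (begin-strict
    M * (M * t' * s)          <⟨ ratio-weaken M Q _ _ M≤Q Q-bound ⟩
    suc M * (M * t * s')      ≡⟨ solve (M ∷ t ∷ s' ∷ []) ⟩
    M * (suc M * t * s')      ∎)
    where
    open ≤-Reasoning
    Q-bound : Q * (M * t' * s) < suc Q * (M * t * s')
    Q-bound = begin-strict
      Q * (M * t' * s)        ≡⟨ solve (Q ∷ M ∷ t' ∷ s ∷ []) ⟩
      M * t' * (Q * s)        ≤⟨ *-monoʳ-≤ (M * t') lo ⟩
      M * t' * (M * t)        <⟨ *-monoˡ-< (M * t) {{m*n≢0 M t}} hi ⟩
      suc Q * s' * (M * t)    ≡⟨ solve (Q ∷ M ∷ t ∷ s' ∷ []) ⟩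
      suc Q * (M * t * s')    ∎

  cancel-common-factor : ∀ M t s u v →
    M * (t * u) * s < suc M * t * (s * v) → M * u < suc M * v
  cancel-common-factor M t s u v lt = *-cancelˡ-< (t * s) _ _ (begin-strict
    t * s * (M * u)           ≡⟨ solve (M ∷ t ∷ s ∷ u ∷ []) ⟩
    M * (t * u) * s           <⟨ lt ⟩
    suc M * t * (s * v)       ≡⟨ solve (M ∷ t ∷ s ∷ v ∷ []) ⟩
    t * s * (suc M * v)       ∎)
    where open ≤-Reasoning

  cancel-common-factor-carry : ∀ M t s u v w →
    M * t * (s * v) < suc M * w * s → 2 * w ≡ t * u → 2 * M * v < suc M * u
  cancel-common-factor-carry M t s u v w lt 2w≡tu = *-cancelˡ-< (t * s) _ _ (begin-strict
    t * s * (2 * M * v)       ≡⟨ solve (M ∷ t ∷ s ∷ v ∷ []) ⟩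
    2 * (M * t * (s * v))     <⟨ *-monoʳ-< 2 lt ⟩
    2 * (suc M * w * s)       ≡⟨ solve (M ∷ w ∷ s ∷ []) ⟩
    suc M * (2 * w) * s       ≡⟨ cong (λ x → suc M * x * s) 2w≡tu ⟩
    suc M * (t * u) * s       ≡⟨ solve (M ∷ t ∷ s ∷ u ∷ []) ⟩
    t * s * (suc M * u)       ∎)
    where open ≤-Reasoning

  -- ρ i = τ i / σ i = 2 · pelem i lies in [1, 2).
  σ τ : ℕ → ℕ
  σ i = 3 ^ i
  τ i = 2 ^ ce i

  σ≢0 : ∀ i → NonZero (σ i)
  σ≢0 i = m^n≢0 3 i

  τ≢0 : ∀ i → NonZero (τ i)
  τ≢0 i = m^n≢0 2 (ce i)

  σ≤τ : ∀ i → σ i ≤ τ i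
  σ≤τ i = n≤2^⌈log₂n⌉ (σ i)

  τ<2σ : ∀ i → τ i < 2 * σ i
  τ<2σ i = 2^⌈log₂n⌉<2n (σ i) {{σ≢0 i}}

  σ<τ : ∀ d .{{_ : NonZero d}} → σ d < τ d
  σ<τ d = ≤∧≢⇒< (σ≤τ d) (λ σ≡τ → 2^m≢3^n (ce d) d (sym σ≡τ))

  σ-+ : ∀ a b → σ (a + b) ≡ σ a * σ b
  σ-+ = ^-distribˡ-+-* 3

  σ-* : ∀ m d → σ (m * d) ≡ σ d ^ m
  σ-* m d = trans (cong (3 ^_) (*-comm m d)) (sym (^-*-assoc 3 d m))

  τ-unique : ∀ i e → σ i ≤ 2 ^ e → 2 ^ e < 2 * σ i → τ i ≡ 2 ^ e
  τ-unique i e lo hi = cong (2 ^_) (⌈log₂⌉-unique e lo hi)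

  τ*τ≡2^ : ∀ a b → τ a * τ b ≡ 2 ^ (ce a + ce b)
  τ*τ≡2^ a b = sym (^-distribˡ-+-* 2 (ce a) (ce b))

  σ≤τ*τ : ∀ a b → σ (a + b) ≤ τ a * τ b
  σ≤τ*τ a b = subst (_≤ τ a * τ b) (sym (σ-+ a b)) (*-mono-≤ (σ≤τ a) (σ≤τ b))

  τ*τ<4σ : ∀ a b → τ a * τ b < 2 * (2 * σ (a + b))
  τ*τ<4σ a b = begin-strict
    τ a * τ b               <⟨ *-mono-< (τ<2σ a) (τ<2σ b) ⟩
    2 * σ a * (2 * σ b)     ≡⟨ regroup (σ a) (σ b) ⟩
    2 * (2 * (σ a * σ b))   ≡⟨ cong (λ x → 2 * (2 * x)) (σ-+ a b) ⟨
    2 * (2 * σ (a + b))     ∎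
    where
    open ≤-Reasoning
    regroup : ∀ x y → 2 * x * (2 * y) ≡ 2 * (2 * (x * y))
    regroup = solve-∀

  τ-submultiplicative : ∀ a b → τ (a + b) ≤ τ a * τ b
  τ-submultiplicative a b = subst (τ (a + b) ≤_) (sym (τ*τ≡2^ a b))
    (^-monoʳ-≤ 2 (⌈log₂⌉-least (ce a + ce b) (subst (σ (a + b) ≤_) (τ*τ≡2^ a b) (σ≤τ*τ a b))))

  τ*τ≤2τ : ∀ a b → τ a * τ b ≤ 2 * τ (a + b)
  τ*τ≤2τ a b = subst (_≤ 2 * τ (a + b)) (sym (τ*τ≡2^ a b)) (^-monoʳ-≤ 2 (≮⇒≥ too-large))
    where
    open ≤-Reasoning
    too-large : suc (ce (a + b)) < ce a + ce b → ⊥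
    too-large lt = <-irrefl refl (<-≤-trans (τ*τ<4σ a b) (begin
      2 * (2 * σ (a + b))     ≤⟨ *-monoʳ-≤ 2 (*-monoʳ-≤ 2 (σ≤τ (a + b))) ⟩
      2 ^ suc (suc (ce (a + b))) ≤⟨ ^-monoʳ-≤ 2 lt ⟩
      2 ^ (ce a + ce b)       ≡⟨ τ*τ≡2^ a b ⟨
      τ a * τ b               ∎))

  τ-+ : ∀ a b → τ a * τ b < 2 * σ (a + b) → τ (a + b) ≡ τ a * τ b
  τ-+ a b no-carry = trans (τ-unique (a + b) (ce a + ce b)
    (subst (σ (a + b) ≤_) (τ*τ≡2^ a b) (σ≤τ*τ a b))
    (subst (_< 2 * σ (a + b)) (τ*τ≡2^ a b) no-carry)) (sym (τ*τ≡2^ a b))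

  τ-+-carry : ∀ a b → 2 * σ (a + b) ≤ τ a * τ b → 2 * τ (a + b) ≡ τ a * τ b
  τ-+-carry a b carry with ce a + ce b in c≡
  ... | zero  = contradiction (<-≤-trans (*-monoʳ-≤ 2 {1} (>-nonZero⁻¹ _ {{σ≢0 (a + b)}})) carry)
                  (≤⇒≯ (≤-reflexive (trans (τ*τ≡2^ a b) (cong (2 ^_) c≡))))
  ... | suc e = trans (cong (2 *_) τ≡2^e) (sym τ*τ≡2·2^e)
    where
    τ*τ≡2·2^e : τ a * τ b ≡ 2 * 2 ^ e
    τ*τ≡2·2^e = trans (τ*τ≡2^ a b) (cong (2 ^_) c≡)
    τ≡2^e : τ (a + b) ≡ 2 ^ e
    τ≡2^e = τ-unique (a + b) e
      (*-cancelˡ-≤ 2 (subst (2 * σ (a + b) ≤_) τ*τ≡2·2^e carry))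
      (*-cancelˡ-< 2 _ _ (subst (_< 2 * (2 * σ (a + b))) τ*τ≡2·2^e (τ*τ<4σ a b)))

  infix 4 _≺_ _≼_

  _≺_ _≼_ : ℕ → ℕ → Set
  i ≺ j = τ i * σ j < τ j * σ i
  i ≼ j = τ i * σ j ≤ τ j * σ i

  Close : ℕ → ℕ → ℕ → Set
  Close M i j = M * τ j * σ i ≤ suc M * τ i * σ j

  JustAboveOne : ℕ → ℕ → Set
  JustAboveOne M d = σ d < τ d × M * τ d ≤ suc M * σ d

  JustBelowTwo : ℕ → ℕ → Set
  JustBelowTwo M i = 2 * M * σ i ≤ suc M * τ i

  IsFloor : ℕ → ℕ → ℕ → Set
  IsFloor M x Q = Q * σ x ≤ M * τ x × M * τ x < suc Q * σ x

  module _ (M : ℕ) .{{M≢0 : NonZero M}} where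

    step-of-equal-floors : ∀ a d Q .{{_ : NonZero d}} → M ≤ Q →
      IsFloor M a Q → IsFloor M (a + d) Q → JustAboveOne M d ⊎ JustBelowTwo M d
    step-of-equal-floors a d Q M≤Q (lo-a , hi-a) (lo-b , hi-b) with τ a * τ d <? 2 * σ (a + d)
    ... | yes no-carry = inj₁ (σ<τ d , <⇒≤ (cancel-common-factor M (τ a) (σ a) (τ d) (σ d) close))
      where
      close : M * (τ a * τ d) * σ a < suc M * τ a * (σ a * σ d)
      close = subst₂ (λ x y → M * x * σ a < suc M * τ a * y) (τ-+ a d no-carry) (σ-+ a d)
        (same-floor-close M Q (τ a) (σ a) (τ (a + d)) (σ (a + d)) {{M≢0}} {{τ≢0 a}} M≤Q lo-a hi-b)
    ... | no carry = inj₂ (<⇒≤ (cancel-common-factor-carry M (τ a) (σ a) (τ d) (σ d) (τ (a + d))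
                                  close (τ-+-carry a d (≮⇒≥ carry))))
      where
      close : M * τ a * (σ a * σ d) < suc M * τ (a + d) * σ a
      close = subst (λ y → M * τ a * y < suc M * τ (a + d) * σ a) (σ-+ a d)
        (same-floor-close M Q (τ (a + d)) (σ (a + d)) (τ a) (σ a) {{M≢0}} {{τ≢0 (a + d)}} M≤Q lo-b hi-a)

    ⌊Mρ⌋ : ℕ → ℕ
    ⌊Mρ⌋ x = _/_ (M * τ x) (σ x) {{σ≢0 x}}

    ⌊Mρ⌋-isFloor : ∀ x → IsFloor M x (⌊Mρ⌋ x)
    ⌊Mρ⌋-isFloor x = m/n*n≤m (M * τ x) (σ x) , hi
      where
      instance _ = σ≢0 x
      hi : M * τ x < suc (⌊Mρ⌋ x) * σ x
      hi = subst (_< suc (⌊Mρ⌋ x) * σ x) (sym (m≡m%n+[m/n]*n (M * τ x) (σ x)))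
        (+-monoˡ-< (⌊Mρ⌋ x * σ x) (m%n<n (M * τ x) (σ x)))

    M≤⌊Mρ⌋ : ∀ x → M ≤ ⌊Mρ⌋ x
    M≤⌊Mρ⌋ x = subst (_≤ ⌊Mρ⌋ x) (m*n/n≡m M (σ x)) (/-monoˡ-≤ (σ x) (*-monoʳ-≤ M (σ≤τ x)))
      where instance _ = σ≢0 x

    ⌊Mρ⌋<M+M : ∀ x → ⌊Mρ⌋ x < M + M
    ⌊Mρ⌋<M+M x = m<n*o⇒m/o<n (begin-strict
      M * τ x                 <⟨ *-monoʳ-< M (τ<2σ x) ⟩
      M * (2 * σ x)           ≡⟨ double M (σ x) ⟩
      (M + M) * σ x           ∎)
      where
      open ≤-Reasoning
      instance _ = σ≢0 x
      double : ∀ m s → m * (2 * s) ≡ (m + m) * s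
      double = solve-∀

    bucket : Fin (suc M) → Fin M
    bucket x = fromℕ< (m<n+o⇒m∸n<o (⌊Mρ⌋ (toℕ x)) M (⌊Mρ⌋<M+M (toℕ x)))

    step-exists : ∃[ d ] NonZero d × (JustAboveOne M d ⊎ JustBelowTwo M d)
    step-exists with i , j , i<j , same-bucket ← pigeonhole (n<1+n M) bucket =
      d , d≢0 , step-of-equal-floors a d Q M≤Q (⌊Mρ⌋-isFloor a) (subst (λ b → IsFloor M b Q) (sym a+d≡b) floor-b)
      where
      a = toℕ i
      b = toℕ j
      d = b ∸ a
      Q = ⌊Mρ⌋ a
      instance d≢0 : NonZero d
      d≢0 = >-nonZero (m<n⇒0<n∸m i<j)
      a+d≡b : a + d ≡ b
      a+d≡b = m+[n∸m]≡n (<⇒≤ i<j)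
      M≤Q = M≤⌊Mρ⌋ a
      floor-b : IsFloor M b Q
      floor-b = subst (IsFloor M b) (sym (∸-cancelʳ-≡ M≤Q (M≤⌊Mρ⌋ b)
        (trans (sym (toℕ-fromℕ< _)) (trans (cong toℕ same-bucket) (toℕ-fromℕ< _))))) (⌊Mρ⌋-isFloor b)

  0≼ : ∀ i → 0 ≼ i
  0≼ i = subst₂ _≤_ (sym (*-identityˡ (σ i))) (sym (*-identityʳ (τ i))) (σ≤τ i)

  ≺⇒σ<τ : ∀ {i j} → i ≺ j → σ j < τ j
  ≺⇒σ<τ {i} {j} i≺j = *-cancelʳ-< (σ i) (σ j) (τ j) (begin-strict
    σ j * σ i   ≤⟨ *-monoʳ-≤ (σ j) (σ≤τ i) ⟩
    σ j * τ i   ≡⟨ *-comm (σ j) (τ i) ⟩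
    τ i * σ j   <⟨ i≺j ⟩
    τ j * σ i   ∎)
    where open ≤-Reasoning

  close-resp-≼ : ∀ M i i′ j → i ≼ i′ → Close M i j → Close M i′ j
  close-resp-≼ M i i′ j i≼i′ close = close-resp-≤ M (τ i) (σ i) (τ j) (σ j) (τ i′) (σ i′) {{σ≢0 i}} close i≼i′

  below-two-resp-≼ : ∀ M i j → i ≼ j → JustBelowTwo M i → JustBelowTwo M j
  below-two-resp-≼ M i j i≼j below = below-two-resp-≤ M (τ i) (σ i) (τ j) (σ j) {{σ≢0 i}} below i≼j

  Covered : ℕ → ℕ → ℕ → Set
  Covered M k i = JustBelowTwo M i ⊎ ∃[ j ] j < k × i ≺ j × Close M i j

  -- Walk along the multiples m d while ρ (m d) = ρ d ^ m ≤ ρ i; each step multiplies ρ by at most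
  -- 1 + 1/M, until a step either wraps past 2 (then ρ i is near 2) or overtakes ρ i.
  module Upward (M : ℕ) .{{M≢0 : NonZero M}} (d : ℕ) .{{d≢0 : NonZero d}}
                (above : JustAboveOne M d) (i : ℕ) where

    Inv Wrap Stop : ℕ → Set
    Inv m = τ (m * d) ≡ τ d ^ m × m * d ≼ i
    Wrap m = 2 * σ (suc m * d) ≤ τ d * τ (m * d)
    Stop m = Wrap m ⊎ i ≺ suc m * d

    Stop? : Decidable Stop
    Stop? m = (2 * σ (suc m * d) ≤? τ d * τ (m * d)) ⊎-dec (τ i * σ (suc m * d) <? τ (suc m * d) * σ i)

    bound : ∀ m → Inv m → m < σ d
    bound m (τ≡ , _) = exponent-bound (σ d) (τ d) m {{σ≢0 d}} (proj₁ above)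
      (subst₂ _<_ τ≡ (cong (2 *_) (σ-* m d)) (τ<2σ (m * d)))

    continue : ∀ m → Inv m → ¬ Stop m → Inv (suc m)
    continue m (τ≡ , _) ¬stop =
      trans (τ-+ d (m * d) (≰⇒> (¬stop ∘ inj₁))) (cong (τ d *_) τ≡) , ≮⇒≥ (¬stop ∘ inj₂)

    conclude : ∀ {m} → Inv m → Stop m → Covered M (τ d * d) i
    conclude {m} (_ , md≼i) (inj₁ wrap) = inj₁ (below-two-resp-≼ M (m * d) i md≼i md-below-two)
      where
      md-below-two : JustBelowTwo M (m * d)
      md-below-two = wrap-below-two M (τ d) (σ d) (τ (m * d)) (σ (m * d)) {{σ≢0 d}} (proj₂ above)
        (subst (λ x → 2 * x ≤ τ d * τ (m * d)) (σ-+ d (m * d)) wrap)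
    conclude {m} inv@(_ , md≼i) (inj₂ i≺j) =
      inj₂ (suc m * d , j<k , i≺j , close-resp-≼ M (m * d) i (suc m * d) md≼i md-close)
      where
      j<k : suc m * d < τ d * d
      j<k = *-monoˡ-< d (<-≤-trans (s≤s (bound m inv)) (proj₁ above))
      md-close : Close M (m * d) (suc m * d)
      md-close = subst (λ x → M * τ (suc m * d) * σ (m * d) ≤ suc M * τ (m * d) * x) (sym (σ-+ d (m * d)))
        (step-up-close M (τ d) (σ d) (τ (m * d)) (σ (m * d)) (τ (suc m * d)) (proj₂ above)
          (τ-submultiplicative d (m * d)))

    covered : Covered M (τ d * d) i
    covered with m , inv , stop ← halts {Inv = Inv} Stop? (σ d) bound continue {0} (refl , 0≼ i) = conclude {m} inv stop

  -- Walk along the multiples m d ≥ d while ρ (m d) = 2 (ρ d / 2) ^ m > ρ i; each step divides ρ by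
  -- at most 1 + 1/M, until a step either drops below 1 or reaches ρ i.
  module Downward (M : ℕ) .{{M≢0 : NonZero M}} (d : ℕ) .{{d≢0 : NonZero d}}
                  (below : JustBelowTwo M d) (i : ℕ) where

    Inv Drop Stop : ℕ → Set
    Inv m = 2 ^ m * τ (m * d) ≡ 2 * τ d ^ m × i ≺ m * d
    Drop m = τ d * τ (m * d) < 2 * σ (suc m * d)
    Stop m = Drop m ⊎ suc m * d ≼ i

    Stop? : Decidable Stop
    Stop? m = (τ d * τ (m * d) <? 2 * σ (suc m * d)) ⊎-dec (τ (suc m * d) * σ i ≤? τ i * σ (suc m * d))

    bound : ∀ m → Inv m → m < τ d
    bound m (pow , i≺md) = exponent-bound (τ d) (2 * σ d) m {{τ≢0 d}} (τ<2σ d) (begin-strict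
      (2 * σ d) ^ m       ≡⟨ ^-distribʳ-* 2 (σ d) m ⟩
      2 ^ m * σ d ^ m     ≡⟨ cong (2 ^ m *_) (σ-* m d) ⟨
      2 ^ m * σ (m * d)   <⟨ *-monoʳ-< (2 ^ m) {{m^n≢0 2 m}} (≺⇒σ<τ {i} {m * d} i≺md) ⟩
      2 ^ m * τ (m * d)   ≡⟨ pow ⟩
      2 * τ d ^ m         ∎)
      where open ≤-Reasoning

    continue : ∀ m → Inv m → ¬ Stop m → Inv (suc m)
    continue m (pow , _) ¬stop = pow′ , ≰⇒> (¬stop ∘ inj₂)
      where
      open ≡-Reasoning
      pow′ : 2 ^ suc m * τ (suc m * d) ≡ 2 * τ d ^ suc m
      pow′ = begin
        2 * 2 ^ m * τ (suc m * d)     ≡⟨ *-assoc 2 (2 ^ m) _ ⟩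
        2 * (2 ^ m * τ (suc m * d))   ≡⟨ x∙yz≈y∙xz 2 (2 ^ m) _ ⟩
        2 ^ m * (2 * τ (suc m * d))   ≡⟨ cong (2 ^ m *_) (τ-+-carry d (m * d) (≮⇒≥ (¬stop ∘ inj₁))) ⟩
        2 ^ m * (τ d * τ (m * d))     ≡⟨ x∙yz≈y∙xz (2 ^ m) (τ d) _ ⟩
        τ d * (2 ^ m * τ (m * d))     ≡⟨ cong (τ d *_) pow ⟩
        τ d * (2 * τ d ^ m)           ≡⟨ x∙yz≈y∙xz (τ d) 2 _ ⟩
        2 * τ d ^ suc m               ∎

    start : i ≺ d → Inv 1
    start i≺d = trans (cong (λ x → 2 * τ x) (*-identityˡ d)) (cong (2 *_) (sym (*-identityʳ (τ d))))
              , subst (i ≺_) (sym (*-identityˡ d)) i≺d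

    conclude : ∀ {m} → Inv m → Stop m → Covered M (τ d * d) i
    conclude {m} inv@(_ , i≺md) stop = inj₂ (m * d , *-monoˡ-< d (bound m inv) , i≺md , close stop)
      where
      close : Stop m → Close M i (m * d)
      close (inj₁ drop) = close-of-above-one M (τ i) (σ i) (τ (m * d)) (σ (m * d))
        (drop-above-one M (τ d) (σ d) (τ (m * d)) (σ (m * d)) {{τ≢0 d}} below
          (<⇒≤ (subst (λ x → τ d * τ (m * d) < 2 * x) (σ-+ d (m * d)) drop)))
        (σ≤τ i)
      close (inj₂ j≼i) = close-resp-≼ M (suc m * d) i (m * d) j≼i
        (subst (λ x → M * τ (m * d) * x ≤ suc M * τ (suc m * d) * σ (m * d)) (sym (σ-+ d (m * d)))
          (step-down-close M (τ d) (σ d) (τ (m * d)) (σ (m * d)) (τ (suc m * d)) {{τ≢0 d}} below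
            (τ*τ≤2τ d (m * d))))

    covered : Covered M (τ d * d) i
    covered with τ i * σ d <? τ d * σ i
    ... | no ¬i≺d = inj₁ (below-two-resp-≼ M d i (≮⇒≥ ¬i≺d) below)
    ... | yes i≺d with m , inv , stop ← halts {Inv = Inv} Stop? (τ d) bound continue {1} (start i≺d) = conclude {m} inv stop

  -- Both walks only visit multiples m d with m < τ d.
  covering : ∀ M .{{_ : NonZero M}} → ∃[ k ] 1 ≤ k × (∀ i → Covered M k i)
  covering M = covering-from-step (step-exists M)
    where
    covering-from-step : ∃[ d ] NonZero d × (JustAboveOne M d ⊎ JustBelowTwo M d) →
                         ∃[ k ] 1 ≤ k × (∀ i → Covered M k i)
    covering-from-step (d , d≢0 , step) =
      τ d * d , >-nonZero⁻¹ (τ d * d) {{m*n≢0 (τ d) d {{τ≢0 d}} {{d≢0}}}} ,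
      [ Upward.covered M d {{d≢0}} , Downward.covered M d {{d≢0}} ]′ step

  top-gap-arith : ∀ M t s → 2 * M * s ≤ suc M * t → t < 2 * s → 1 * (2 * s * M) < (t * M + 1 * (2 * s)) * 1
  top-gap-arith M t s below t<2s = begin-strict
    1 * (2 * s * M)           ≡⟨ solve (M ∷ s ∷ []) ⟩
    2 * M * s                 ≤⟨ below ⟩
    suc M * t                 ≡⟨ solve (M ∷ t ∷ []) ⟩
    t * M + t                 <⟨ +-monoʳ-< (t * M) t<2s ⟩
    t * M + 2 * s             ≡⟨ solve (M ∷ t ∷ s ∷ []) ⟩
    (t * M + 1 * (2 * s)) * 1 ∎
    where open ≤-Reasoning

  gap-arith : ∀ M t s t′ s′ .{{_ : NonZero s′}} →
    M * t′ * s ≤ suc M * t * s′ → t < 2 * s → t′ * (2 * s * M) < (t * M + 1 * (2 * s)) * (2 * s′)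
  gap-arith M t s t′ s′ close t<2s = begin-strict
    t′ * (2 * s * M)                    ≡⟨ solve (M ∷ s ∷ t′ ∷ []) ⟩
    2 * (M * t′ * s)                    ≤⟨ *-monoʳ-≤ 2 close ⟩
    2 * (suc M * t * s′)                ≡⟨ solve (M ∷ t ∷ s′ ∷ []) ⟩
    2 * (M * t * s′) + 2 * (t * s′)     <⟨ +-monoʳ-< (2 * (M * t * s′)) (*-monoʳ-< 2 (*-monoˡ-< s′ t<2s)) ⟩
    2 * (M * t * s′) + 2 * (2 * s * s′) ≡⟨ solve (M ∷ t ∷ s ∷ s′ ∷ []) ⟩
    (t * M + 1 * (2 * s)) * (2 * s′)    ∎
    where open ≤-Reasoning

  mono-arith : ∀ t s t′ s′ → t * s′ < t′ * s → t * (2 * s′) < t′ * (2 * s)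
  mono-arith t s t′ s′ lt = begin-strict
    t * (2 * s′)              ≡⟨ solve (t ∷ s′ ∷ []) ⟩
    2 * (t * s′)              <⟨ *-monoʳ-< 2 lt ⟩
    2 * (t′ * s)              ≡⟨ solve (t′ ∷ s ∷ []) ⟩
    t′ * (2 * s)              ∎
    where open ≤-Reasoning

open import Defs
open import Data.Nat using (ℕ) renaming (_≤_ to _≤ℕ_)
open import Data.Rational using (ℚ; 0ℚ; 1ℚ; _<_; _-_)
open import Data.Product using (Σ; _×_)
open import Data.List using (List; _∷_; []; _++_)
open import Data.List.Membership.Propositional using (_∈_)
open import Data.List.Relation.Unary.Linked using (Linked)
open import Function.Bundles using (_⇔_)

open import Data.Empty using (⊥-elim)
import Data.Integer.Base as ℤ
open import Data.Integer.Base using (+_; +<+)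
import Data.Integer.Properties as ℤ
open import Data.List.Membership.Propositional.Properties using (∈-map⁺; ∈-map⁻; ∈-upTo⁺)
open import Data.List.Relation.Unary.Any using (here; there)
open import Data.List.Relation.Unary.Linked using ([-]; _∷_)
import Data.Nat.Base as ℕ
import Data.Nat.Properties as ℕ
open import Data.Product using (∃-syntax; _,_)
open import Data.Rational.Base using (mkℚ; _/_; _+_; -_; _≤_; toℚᵘ; *<*)
import Data.Rational.Properties as ℚ
open import Algebra.Properties.AbelianGroup ℚ.+-0-abelianGroup using (xyx⁻¹≈y)
import Data.Rational.Unnormalised.Base as ℚᵘ
open import Data.Rational.Unnormalised.Base using (mkℚᵘ)
import Data.Rational.Unnormalised.Properties as ℚᵘ
open import Data.Sum using (_⊎_; inj₁; inj₂)
open import Function.Base using (_∘_)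
open import Function.Bundles using (Equivalence)
open import Relation.Binary.PropositionalEquality

open Ratios using (σ; τ; σ≢0; τ<2σ; _≺_; Close; JustBelowTwo; Covered; covering; top-gap-arith; gap-arith; mono-arith)

toℚᵘ-/ : ∀ a n .{{_ : ℕ.NonZero n}} → toℚᵘ (+ a / n) ℚᵘ.≃ + a ℚᵘ./ n
toℚᵘ-/ a (ℕ.suc n) = ℚ.toℚᵘ-fromℚᵘ (mkℚᵘ (+ a) n)

/ᵘ-<-/ᵘ : ∀ a b c d .{{_ : ℕ.NonZero b}} .{{_ : ℕ.NonZero d}} →
  a ℕ.* d ℕ.< c ℕ.* b → + a ℚᵘ./ b ℚᵘ.< + c ℚᵘ./ d
/ᵘ-<-/ᵘ a (ℕ.suc b) c (ℕ.suc d) lt = ℚᵘ.*<* (subst₂ ℤ._<_ (ℤ.pos-* a (ℕ.suc d)) (ℤ.pos-* c (ℕ.suc b)) (+<+ lt))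

/ᵘ+/ᵘ : ∀ c d e f .{{_ : ℕ.NonZero d}} .{{_ : ℕ.NonZero f}} →
  (+ c ℚᵘ./ d) ℚᵘ.+ (+ e ℚᵘ./ f) ℚᵘ.≃ ℚᵘ._/_ (+ (c ℕ.* f ℕ.+ e ℕ.* d)) (d ℕ.* f) {{ℕ.m*n≢0 d f}}
/ᵘ+/ᵘ c (ℕ.suc d) e (ℕ.suc f) = ℚᵘ.≃-reflexive (cong (λ n → n ℚᵘ./ (ℕ.suc d ℕ.* ℕ.suc f))
  (trans (cong₂ ℤ._+_ (sym (ℤ.pos-* c (ℕ.suc f))) (sym (ℤ.pos-* e (ℕ.suc d))))
         (sym (ℤ.pos-+ (c ℕ.* ℕ.suc f) (e ℕ.* ℕ.suc d)))))

/-<-/ : ∀ a b c d .{{_ : ℕ.NonZero b}} .{{_ : ℕ.NonZero d}} →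
  a ℕ.* d ℕ.< c ℕ.* b → + a / b < + c / d
/-<-/ a b c d lt = ℚ.toℚᵘ-cancel-<
  (ℚᵘ.<-respˡ-≃ (ℚᵘ.≃-sym (toℚᵘ-/ a b)) (ℚᵘ.<-respʳ-≃ (ℚᵘ.≃-sym (toℚᵘ-/ c d)) (/ᵘ-<-/ᵘ a b c d lt)))

/-<-/+/ : ∀ a b c d e f .{{_ : ℕ.NonZero b}} .{{_ : ℕ.NonZero d}} .{{_ : ℕ.NonZero f}} →
  a ℕ.* (d ℕ.* f) ℕ.< (c ℕ.* f ℕ.+ e ℕ.* d) ℕ.* b → + a / b < + c / d + + e / f
/-<-/+/ a b c d e f {{b≢0}} {{d≢0}} {{f≢0}} lt = ℚ.toℚᵘ-cancel-<
  (ℚᵘ.<-respˡ-≃ (ℚᵘ.≃-sym (toℚᵘ-/ a b)) (ℚᵘ.<-respʳ-≃ (ℚᵘ.≃-sym sum≃)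
    (/ᵘ-<-/ᵘ a b _ (d ℕ.* f) {{b≢0}} {{ℕ.m*n≢0 d f}} lt)))
  where
  sum≃ : toℚᵘ (+ c / d + + e / f) ℚᵘ.≃ ℚᵘ._/_ (+ (c ℕ.* f ℕ.+ e ℕ.* d)) (d ℕ.* f) {{ℕ.m*n≢0 d f}}
  sum≃ = ℚᵘ.≃-trans (ℚ.toℚᵘ-homo-+ (+ c / d) (+ e / f))
           (ℚᵘ.≃-trans (ℚᵘ.+-cong (toℚᵘ-/ c d) (toℚᵘ-/ e f)) (/ᵘ+/ᵘ c d e f))

<+⇒-< : ∀ p {q e} → q < p + e → q - p < e
<+⇒-< p {q} {e} lt = subst (q - p <_) (xyx⁻¹≈y p e) (ℚ.+-monoˡ-< (- p) lt)

archimedean : ∀ ε → 0ℚ < ε → ∃[ M ] + 1 / ℕ.suc M < ε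
archimedean ε@(mkℚ (+ ℕ.suc n) d _) _ = ℕ.suc d , subst (+ 1 / ℕ.suc (ℕ.suc d) <_) (ℚ.↥p/↧p≡p ε)
  (/-<-/ 1 (ℕ.suc (ℕ.suc d)) (ℕ.suc n) (ℕ.suc d)
    (ℕ.<-≤-trans (subst (ℕ._< ℕ.suc (ℕ.suc d)) (sym (ℕ.*-identityˡ _)) (ℕ.n<1+n _)) (ℕ.m≤n*m _ (ℕ.suc n))))
archimedean (mkℚ (+ 0) _ _) (*<* (+<+ ()))
archimedean (mkℚ ℤ.-[1+ _ ] _ _) (*<* ())

head≤ : ∀ {x y xs} → Linked _<_ (x ∷ xs) → y ∈ x ∷ xs → x ≤ y
head≤ _ (here refl) = ℚ.≤-refl
head≤ (x<z ∷ sorted) (there y∈) = ℚ.≤-trans (ℚ.<⇒≤ x<z) (head≤ sorted y∈)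

HasNearSuccessor : ℚ → ℚ → List ℚ → ℚ → Set
HasNearSuccessor ε top xs a = (top - a < ε) ⊎ ∃[ c ] c ∈ xs × a < c × c - a < ε

gaps-below : ∀ {ε top} xs → Linked _<_ xs → (∀ {x} → x ∈ xs → x < top) →
  (∀ {a} → a ∈ xs → HasNearSuccessor ε top xs a) → Linked (λ a b → b - a < ε) (xs ++ top ∷ [])
gaps-below [] _ _ _ = [-]
gaps-below (a ∷ []) _ _ near with near (here refl)
... | inj₁ gap = gap ∷ [-]
... | inj₂ (c , here refl , a<a , _) = ⊥-elim (ℚ.<-irrefl refl a<a)
gaps-below {ε} {top} (a ∷ b ∷ xs) (a<b ∷ sorted) below near =
  gap ∷ gaps-below (b ∷ xs) sorted (below ∘ there) (λ x∈ → drop-head x∈ (near (there x∈)))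
  where
  gap : b - a < ε
  gap with near (here refl)
  ... | inj₁ top-gap = ℚ.<-trans (ℚ.+-monoˡ-< (- a) (below (there (here refl)))) top-gap
  ... | inj₂ (c , here refl , a<a , _) = ⊥-elim (ℚ.<-irrefl refl a<a)
  ... | inj₂ (c , there c∈ , _ , c-gap) = ℚ.≤-<-trans (ℚ.+-monoˡ-≤ (- a) (head≤ sorted c∈)) c-gap
  drop-head : ∀ {x} → x ∈ b ∷ xs → HasNearSuccessor ε top (a ∷ b ∷ xs) x → HasNearSuccessor ε top (b ∷ xs) x
  drop-head _  (inj₁ top-gap) = inj₁ top-gap
  drop-head x∈ (inj₂ (c , here refl , x<a , _)) =
    ⊥-elim (ℚ.<-irrefl refl (ℚ.<-trans a<b (ℚ.≤-<-trans (head≤ sorted x∈) x<a)))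
  drop-head _  (inj₂ (c , there c∈ , x<c , c-gap)) = inj₂ (c , c∈ , x<c , c-gap)

pelem<1 : ∀ i → pelem i < 1ℚ
pelem<1 i = /-<-/ (τ i) (den i) 1 1 {{den≢0 i}}
  (subst₂ ℕ._<_ (sym (ℕ.*-identityʳ (τ i))) (sym (ℕ.*-identityˡ (den i))) (τ<2σ i))

pelem-mono : ∀ i j → i ≺ j → pelem i < pelem j
pelem-mono i j i≺j = /-<-/ (τ i) (den i) (τ j) (den j) {{den≢0 i}} {{den≢0 j}} (mono-arith (τ i) (σ i) (τ j) (σ j) i≺j)

module _ (M : ℕ) .{{M≢0 : ℕ.NonZero M}} where

  top-gap : ∀ i → JustBelowTwo M i → 1ℚ - pelem i < + 1 / M
  top-gap i below = <+⇒-< (pelem i) (/-<-/+/ 1 1 (τ i) (den i) 1 M {{_}} {{den≢0 i}} (top-gap-arith M (τ i) (σ i) below (τ<2σ i)))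

  gap : ∀ i j → Close M i j → pelem j - pelem i < + 1 / M
  gap i j close = <+⇒-< (pelem i) (/-<-/+/ (τ j) (den j) (τ i) (den i) 1 M {{den≢0 j}} {{den≢0 i}}
    (gap-arith M (τ i) (σ i) (τ j) (σ j) {{σ≢0 j}} close (τ<2σ i)))

  P-gaps : ∀ {ε} → + 1 / M < ε → ∀ k → (∀ i → Covered M k i) →
    (ps : List ℚ) → Linked _<_ ps → ((x : ℚ) → (x ∈ ps) ⇔ (x ∈ P k)) →
    Linked (λ a b → (b - a) < ε) (ps ++ (1ℚ ∷ []))
  P-gaps {ε} 1/M<ε k covered ps sorted ps≈Pk = gaps-below ps sorted below-1 near
    where
    index-of : ∀ {x} → x ∈ ps → ∃[ i ] x ≡ pelem i
    index-of x∈ = let (i , _ , x≡) = ∈-map⁻ pelem (Equivalence.to (ps≈Pk _) x∈) in i , x≡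

    below-1 : ∀ {x} → x ∈ ps → x < 1ℚ
    below-1 x∈ = let (i , x≡) = index-of x∈ in subst (_< 1ℚ) (sym x≡) (pelem<1 i)

    near-pelem : ∀ i → Covered M k i → HasNearSuccessor ε 1ℚ ps (pelem i)
    near-pelem i (inj₁ below) = inj₁ (ℚ.<-trans (top-gap i below) 1/M<ε)
    near-pelem i (inj₂ (j , j<k , i≺j , close)) =
      inj₂ (pelem j , Equivalence.from (ps≈Pk _) (∈-map⁺ pelem (∈-upTo⁺ j<k)) ,
            pelem-mono i j i≺j , ℚ.<-trans (gap i j close) 1/M<ε)

    near : ∀ {a} → a ∈ ps → HasNearSuccessor ε 1ℚ ps a
    near a∈ = let (i , a≡) = index-of a∈ in subst (HasNearSuccessor ε 1ℚ ps) (sym a≡) (near-pelem i (covered i))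

corollary2 : (ε : ℚ) → 0ℚ < ε →
    Σ ℕ (λ k → (1 ≤ℕ k) ×
      ((ps : List ℚ) → Linked _<_ ps → ((x : ℚ) → (x ∈ ps) ⇔ (x ∈ P k)) →
        Linked (λ a b → (b - a) < ε) (ps ++ (1ℚ ∷ []))))
corollary2 ε 0<ε =
  let (M′ , 1/M<ε) = archimedean ε 0<ε
      (k , 1≤k , covered) = covering (ℕ.suc M′)
  in k , 1≤k , P-gaps (ℕ.suc M′) 1/M<ε k covered
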